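{- Let $G$ be a prime graph and let $a\not\in V(G)$. Then the number of distinct prime graphs $H$ with vertex set $V(G)\cup\{a\}$ such that $H[V(G)]=G$ is exactly $2^{|V(G)|}-2|V(G)|-2$.
   Context: Graphs are finite, simple and undirected. For $W\subseteq V(H)$, $H[W]$ is the induced subgraph. A subset $M\subseteq V(G)$ is a module of $G$ if every $v\in V(G)\setminus M$ is adjacent either to all vertices of $M$ or to none of them; the modules $\emptyset$, $V(G)$ and the singletons are trivial. A graph $G$ is prime if $|V(G)|\geq 4$ and all its modules are trivial. -}

module Defs where

open import Data.Nat using (ℕ; suc; _≤_)
open import Data.Bool using (Bool; true; false)
open import Data.Fin using (Fin)
open import Data.Fin.Subset using (Subset; _∈_; _∉_; ⊥; ⊤; ⁅_⁆)
open import Data.Product using (Σ; ∃; _×_)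
open import Data.Sum using (_⊎_)
open import Relation.Binary.PropositionalEquality using (_≡_)

record Graph (n : ℕ) : Set where
  field
    adj    : Fin n → Fin n → Bool
    sym    : ∀ i j → adj i j ≡ adj j i
    irrefl : ∀ i → adj i i ≡ false
open Graph public

_≈G_ : ∀ {n} → Graph n → Graph n → Set
G ≈G H = ∀ i j → adj G i j ≡ adj H i j

IsModule : ∀ {n} → Graph n → Subset n → Set
IsModule {n} G M =
  ∀ (v : Fin n) → v ∉ M →
    (∀ x → x ∈ M → adj G v x ≡ true) ⊎ (∀ x → x ∈ M → adj G v x ≡ false)

Trivial : ∀ {n} → Subset n → Set
Trivial {n} M = (M ≡ ⊥) ⊎ (M ≡ ⊤) ⊎ (Σ (Fin n) λ i → M ≡ ⁅ i ⁆)

Prime : ∀ {n} → Graph n → Set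
Prime {n} G = (4 ≤ n) × (∀ M → IsModule G M → Trivial M)

-- Induced subgraph of a graph on Fin (suc n) (vertex set {a} ∪ V(G), with the
-- new vertex a = zero) on the old vertices V(G) = image of suc.
restrict : ∀ {n} → Graph (suc n) → Graph n
restrict H = record
  { adj    = λ i j → adj H (Fin.suc i) (Fin.suc j)
  ; sym    = λ i j → sym H (Fin.suc i) (Fin.suc j)
  ; irrefl = λ i → irrefl H (Fin.suc i)
  }

module Submission where

-- Extending a prime graph G on V = {0..n-1} by a new vertex a amounts to
-- choosing the neighbourhood N ⊆ V of a.  The extension is prime exactly
-- when N is none of the 2n+2 "forbidden" sets
--   ∅ and V            (otherwise V is a nontrivial module), and
--   N(v) and N[v]      (otherwise {a, v} is a nontrivial module, a and v
--                       being false resp. true twins),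
-- and these 2n+2 sets are pairwise distinct because G has no vertex
-- adjacent to all or to none of the others and no pair of twins.
-- Hence there are exactly 2^n - 2n - 2 prime extensions.

open import Defs
open import Data.Nat using (ℕ; zero; suc; _+_; _^_; _*_; _∸_; _≤_; z≤n; s≤s)
open import Data.Nat.Properties using (≤-antisym; ≤-trans; <⇒≤; +-suc; +-identityʳ; m+n∸m≡n; ∸-+-assoc)
open import Data.Bool using (Bool; true; false)
import Data.Bool as Bool
open import Data.Fin using (Fin; zero; suc; fromℕ<)
open import Data.Fin.Properties using (any?; injective⇒≤; +↔⊎; *↔×; 2↔Bool)
  renaming (_≟_ to _≟ᶠ_)
open import Data.Fin.Subset using (Subset; _∈_; _∉_; ⁅_⁆; ∁; _∪_) renaming (⊥ to ∅; ⊤ to full)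
open import Data.Fin.Subset.Properties
  using (∉⊥; ∈⊤; x∈⁅x⁆; x∈⁅y⁆⇒x≡y; x≢y⇒x∉⁅y⁆; x∉⁅y⁆⇒x≢y; x∈∁p⇒x∉p; x∉p⇒x∈∁p; x∈p∪q⁻; x∈p∪q⁺)
open import Data.List using (List; []; _∷_; length; lookup; filter; map; _++_)
open import Data.List.Properties using (length-map; length-++)
import Data.List.Membership.Propositional as List
open import Data.List.Membership.Propositional.Properties
  using (∈-lookup; ∈-filter⁺; ∈-filter⁻; ∈-map⁺; ∈-map⁻; ∈-++⁺ˡ; ∈-++⁺ʳ)
open import Data.List.Relation.Unary.All as All using ()
open import Data.List.Relation.Unary.Any using (here; index)
open import Data.List.Relation.Unary.Any.Properties using (lookup-index)
open import Data.List.Relation.Unary.Unique.Propositional using (Unique; []; _∷_)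
import Data.List.Relation.Unary.Unique.Propositional.Properties as Unique
open import Data.Vec using ([]; _∷_; tabulate; here; there) renaming (lookup to at)
open import Data.Vec.Properties using (lookup∘tabulate; tabulate∘lookup; tabulate-cong; ∷-injectiveʳ; ≡-dec)
open import Data.Product using (Σ; ∃; _×_; _,_; proj₁; proj₂)
open import Data.Sum using (_⊎_; inj₁; inj₂)
import Data.Sum as Sum
open import Data.Sum.Function.Propositional using (_⊎-↔_)
open import Data.Product.Function.NonDependent.Propositional using (_×-↔_)
open import Function using (_∘_; _↔_; Inverse; mk↔ₛ′; case_of_)
open import Function.Definitions using (Injective)
open import Function.Properties.Inverse using (↔-refl; ↔-trans; Inverse⇒Injection)
import Function.Bundles
open import Relation.Binary using (DecidableEquality)
open import Relation.Binary.PropositionalEquality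
  using (_≡_; _≢_; ≢-sym; refl; trans; cong; cong₂; subst; module ≡-Reasoning)
  renaming (sym to ≡-sym)
open import Relation.Nullary using (¬_; yes; no; ¬?; contradiction)
open import Relation.Unary using (Pred; Decidable)
open import Level using (0ℓ)

module _ {A : Set} where

  lookup-injective : ∀ {xs : List A} → Unique xs → Injective _≡_ _≡_ (lookup xs)
  lookup-injective (_ ∷ _) {zero} {zero} _ = refl
  lookup-injective (x∉xs ∷ _) {zero} {suc j} eq = contradiction eq (All.lookup x∉xs (∈-lookup j))
  lookup-injective (x∉xs ∷ _) {suc i} {zero} eq = contradiction (≡-sym eq) (All.lookup x∉xs (∈-lookup i))
  lookup-injective (_ ∷ u) {suc i} {suc j} eq = cong suc (lookup-injective u eq)

  Lists : ∀ {K} → (Fin K → A) → Pred A 0ℓ → Set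
  Lists e P = Injective _≡_ _≡_ e × (∀ i → P (e i)) × (∀ a → P a → ∃ λ i → e i ≡ a)

  list-enumeration : ∀ {ys : List A} → Unique ys → ∀ {K} → length ys ≡ K →
    Σ (Fin K → A) λ e → Lists e (List._∈ ys)
  list-enumeration {ys} u refl =
    lookup ys , lookup-injective u , ∈-lookup , λ _ y∈ys → index y∈ys , ≡-sym (lookup-index y∈ys)

  -- A duplicate-free list whose members are listed by Fin k has length k
  -- (positions and preimages give an injection in each direction).
  length-listed : ∀ {k} {b : Fin k → A} {ys : List A} → Unique ys → Lists b (List._∈ ys) → length ys ≡ k
  length-listed {k} {b} {ys} u (b-inj , into , onto) =
    ≤-antisym (injective⇒≤ preimage-inj) (injective⇒≤ position-inj)
    where
    position : Fin k → Fin (length ys)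
    position i = index (into i)
    position-inj : Injective _≡_ _≡_ position
    position-inj {i} {j} eq = b-inj (begin
      b i                       ≡⟨ lookup-index (into i) ⟩
      lookup ys (position i)    ≡⟨ cong (lookup ys) eq ⟩
      lookup ys (position j)    ≡⟨ lookup-index (into j) ⟨
      b j                       ∎)
      where open ≡-Reasoning
    preimage : Fin (length ys) → Fin k
    preimage j = proj₁ (onto _ (∈-lookup j))
    preimage-inj : Injective _≡_ _≡_ preimage
    preimage-inj {i} {j} eq = lookup-injective u (begin
      lookup ys i               ≡⟨ proj₂ (onto _ (∈-lookup i)) ⟨
      b (preimage i)            ≡⟨ cong b eq ⟩
      b (preimage j)            ≡⟨ proj₂ (onto _ (∈-lookup j)) ⟩
      lookup ys j               ∎)
      where open ≡-Reasoning

  length-filter-split : ∀ {P : Pred A 0ℓ} (P? : Decidable P) xs →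
    length (filter P? xs) + length (filter (¬? ∘ P?) xs) ≡ length xs
  length-filter-split P? [] = refl
  length-filter-split P? (x ∷ xs) with P? x
  ... | yes _ = cong suc (length-filter-split P? xs)
  ... | no  _ = trans (+-suc _ _) (cong suc (length-filter-split P? xs))

  complement-enumeration : DecidableEquality A → ∀ {xs : List A} → Unique xs → (∀ a → a List.∈ xs) →
    ∀ {B : Set} {k} → Fin k ↔ B → (g : B → A) → Injective _≡_ _≡_ g →
    ∀ {K} → length xs ∸ k ≡ K →
    Σ (Fin K → A) λ e → Lists e (λ a → ∀ s → g s ≢ a)
  complement-enumeration _≟_ {xs} xs-unique xs-complete {k = k} code g g-inj {K} size =
    let (e , e-inj , e∈rest , rest⊆e) = list-enumeration (Unique.filter⁺ outside? xs-unique) rest-size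
    in  e , e-inj , (λ i → outside-image (proj₂ (∈-filter⁻ outside? {xs = xs} (e∈rest i)))) ,
        λ a a∉g → rest⊆e a (∈-filter⁺ outside? (xs-complete a) λ { (i , eq) → a∉g (to i) eq })
    where
    open Inverse code using (to; from; strictlyInverseˡ)
    b : Fin k → A
    b = g ∘ to
    b-inj : Injective _≡_ _≡_ b
    b-inj = Function.Bundles.Injection.injective (Inverse⇒Injection code) ∘ g-inj
    inImage? : Decidable (λ a → ∃ λ i → b i ≡ a)
    inImage? a = any? (λ i → b i ≟ a)
    outside? : Decidable (λ a → ¬ ∃ λ i → b i ≡ a)
    outside? = ¬? ∘ inImage?
    outside-image : ∀ {a} → ¬ (∃ λ i → b i ≡ a) → ∀ s → g s ≢ a
    outside-image a∉b s gs≡a = a∉b (from s , trans (cong g (strictlyInverseˡ s)) gs≡a)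
    image rest : List A
    image = filter inImage? xs
    rest  = filter outside? xs
    image-size : length image ≡ k
    image-size = length-listed (Unique.filter⁺ inImage? xs-unique)
      ( b-inj
      , (λ i → ∈-filter⁺ inImage? (xs-complete (b i)) (i , refl))
      , (λ _ y∈ → proj₂ (∈-filter⁻ inImage? {xs = xs} y∈)))
    rest-size : length rest ≡ K
    rest-size = begin
      length rest                      ≡⟨ m+n∸m≡n k (length rest) ⟨
      k + length rest ∸ k              ≡⟨ cong (λ j → j + length rest ∸ k) image-size ⟨
      length image + length rest ∸ k   ≡⟨ cong (_∸ k) (length-filter-split inImage? xs) ⟩
      length xs ∸ k                    ≡⟨ size ⟩
      K                                ∎
      where open ≡-Reasoning

allSubsets : ∀ n → List (Subset n)
allSubsets zero    = [] ∷ []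
allSubsets (suc n) = map (true ∷_) (allSubsets n) ++ map (false ∷_) (allSubsets n)

allSubsets-complete : ∀ {n} (N : Subset n) → N List.∈ allSubsets n
allSubsets-complete []          = here refl
allSubsets-complete (true ∷ N)  = ∈-++⁺ˡ (∈-map⁺ (true ∷_) (allSubsets-complete N))
allSubsets-complete (false ∷ N) = ∈-++⁺ʳ _ (∈-map⁺ (false ∷_) (allSubsets-complete N))

allSubsets-unique : ∀ n → Unique (allSubsets n)
allSubsets-unique zero    = All.[] ∷ []
allSubsets-unique (suc n) =
  Unique.++⁺ (Unique.map⁺ ∷-injectiveʳ (allSubsets-unique n)) (Unique.map⁺ ∷-injectiveʳ (allSubsets-unique n))
    disjoint
  where
  disjoint : ∀ {N} → ¬ (N List.∈ map (true ∷_) (allSubsets n) × N List.∈ map (false ∷_) (allSubsets n))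
  disjoint (N∈ , N∈′) with ∈-map⁻ (true ∷_) N∈ | ∈-map⁻ (false ∷_) N∈′
  ... | _ , _ , refl | _ , _ , ()

allSubsets-length : ∀ n → length (allSubsets n) ≡ 2 ^ n
allSubsets-length zero    = refl
allSubsets-length (suc n) = begin
  length (map (true ∷_) S ++ map (false ∷_) S)
    ≡⟨ length-++ (map (true ∷_) S) ⟩
  length (map (true ∷_) S) + length (map (false ∷_) S)
    ≡⟨ cong₂ _+_ (length-map (true ∷_) S) (length-map (false ∷_) S) ⟩
  length S + length S
    ≡⟨ cong₂ _+_ (allSubsets-length n) (allSubsets-length n) ⟩
  2 ^ n + 2 ^ n
    ≡⟨ cong (2 ^ n +_) (+-identityʳ (2 ^ n)) ⟨
  2 * 2 ^ n                                          ∎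
  where
  open ≡-Reasoning
  S = allSubsets n

third-vertex : ∀ {k} → 3 ≤ k → (v w : Fin k) → ∃ λ z → z ≢ v × z ≢ w
third-vertex (s≤s (s≤s (s≤s _))) zero          zero          = suc zero , (λ ()) , (λ ())
third-vertex (s≤s (s≤s (s≤s _))) zero          (suc zero)    = suc (suc zero) , (λ ()) , (λ ())
third-vertex (s≤s (s≤s (s≤s _))) zero          (suc (suc _)) = suc zero , (λ ()) , (λ ())
third-vertex (s≤s (s≤s (s≤s _))) (suc zero)    zero          = suc (suc zero) , (λ ()) , (λ ())
third-vertex (s≤s (s≤s (s≤s _))) (suc zero)    (suc _)       = zero , (λ ()) , (λ ())
third-vertex (s≤s (s≤s (s≤s _))) (suc (suc _)) zero          = suc zero , (λ ()) , (λ ())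
third-vertex (s≤s (s≤s (s≤s _))) (suc (suc _)) (suc zero)    = zero , (λ ()) , (λ ())
third-vertex (s≤s (s≤s (s≤s _))) (suc (suc _)) (suc (suc _)) = zero , (λ ()) , (λ ())

subset-ext : ∀ {k} {f : Fin k → Bool} {N : Subset k} → (∀ x → f x ≡ at N x) → tabulate f ≡ N
subset-ext {N = N} f≗N = trans (tabulate-cong f≗N) (tabulate∘lookup N)

nontrivial : ∀ {k} {M : Subset k} {x y z : Fin k} → x ∈ M → y ∈ M → x ≢ y → z ∉ M → ¬ Trivial M
nontrivial x∈M _   _   _   (inj₁ refl)               = ∉⊥ x∈M
nontrivial _   _   _   z∉M (inj₂ (inj₁ refl))        = z∉M ∈⊤
nontrivial x∈M y∈M x≢y _   (inj₂ (inj₂ (i , refl))) =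
  x≢y (trans (x∈⁅y⁆⇒x≡y i x∈M) (≡-sym (x∈⁅y⁆⇒x≡y i y∈M)))

module-intro : ∀ {k} (H : Graph k) (M : Subset k) →
  (∀ v → v ∉ M → ∃ λ c → ∀ x → x ∈ M → adj H v x ≡ c) → IsModule H M
module-intro H M common v v∉M with common v v∉M
... | true  , sees = inj₁ sees
... | false , sees = inj₂ sees

module-elim : ∀ {k} (H : Graph k) (M : Subset k) → IsModule H M →
  ∀ v → v ∉ M → ∃ λ c → ∀ x → x ∈ M → adj H v x ≡ c
module-elim H M isModule v v∉M with isModule v v∉M
... | inj₁ sees = true  , sees
... | inj₂ sees = false , sees

prime-≈ : ∀ {k} {H H′ : Graph k} → H ≈G H′ → Prime H′ → Prime H
prime-≈ {H = H} {H′} H≈H′ (4≤k , trivial) = 4≤k , λ M isModule →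
  trivial M (module-intro H′ M λ v v∉M →
    let (c , sees) = module-elim H M isModule v v∉M
    in  c , λ x x∈M → trans (≡-sym (H≈H′ v x)) (sees x x∈M))

module-restrict : ∀ {k} {H : Graph (suc k)} {m : Bool} {M : Subset k} →
  IsModule H (m ∷ M) → IsModule (restrict H) M
module-restrict {H = H} {m} {M} isModule = module-intro (restrict H) M λ v v∉M →
  let (c , sees) = module-elim H (m ∷ M) isModule (suc v) (λ { (there v∈M) → v∉M v∈M }) in
  c , λ x x∈M → sees (suc x) (there x∈M)

-- Names for the neighbourhoods of a new vertex that spoil primality:
-- uniform false = ∅, uniform true = V; twin false v = N(v), twin true v = N[v].
data Forbidden (n : ℕ) : Set where
  uniform : Bool → Forbidden n
  twin    : Bool → Fin n → Forbidden n

forbidden-code : ∀ {n} → Fin (2 * n + 2) ↔ Forbidden n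
forbidden-code {n} = ↔-trans +↔⊎ (↔-trans ((↔-trans *↔× (2↔Bool ×-↔ ↔-refl)) ⊎-↔ 2↔Bool) shape)
  where
  shape : ((Bool × Fin n) ⊎ Bool) ↔ Forbidden n
  shape = mk↔ₛ′ (λ { (inj₁ (c , v)) → twin c v ; (inj₂ c) → uniform c })
                (λ { (twin c v) → inj₁ (c , v) ; (uniform c) → inj₂ c })
                (λ { (twin _ _) → refl ; (uniform _) → refl })
                (λ { (inj₁ _) → refl ; (inj₂ _) → refl })

module Extension {n : ℕ} (G : Graph n) where

  extend : Subset n → Graph (suc n)
  extend N = record { adj = extendAdj ; sym = extendAdj-sym ; irrefl = extendAdj-irrefl }
    where
    extendAdj : Fin (suc n) → Fin (suc n) → Bool
    extendAdj zero    zero    = false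
    extendAdj zero    (suc j) = at N j
    extendAdj (suc i) zero    = at N i
    extendAdj (suc i) (suc j) = adj G i j
    extendAdj-sym : ∀ i j → extendAdj i j ≡ extendAdj j i
    extendAdj-sym zero    zero    = refl
    extendAdj-sym zero    (suc j) = refl
    extendAdj-sym (suc i) zero    = refl
    extendAdj-sym (suc i) (suc j) = sym G i j
    extendAdj-irrefl : ∀ i → extendAdj i i ≡ false
    extendAdj-irrefl zero    = refl
    extendAdj-irrefl (suc i) = irrefl G i

  restrict-extend : ∀ N → restrict (extend N) ≈G G
  restrict-extend N _ _ = refl

  extend-injective : ∀ {N N′} → extend N ≈G extend N′ → N ≡ N′
  extend-injective {N} {N′} N≈N′ = trans (≡-sym (tabulate∘lookup N)) (subset-ext (λ j → N≈N′ zero (suc j)))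

  attachment : Graph (suc n) → Subset n
  attachment H = tabulate (λ j → adj H zero (suc j))

  extend-attachment : ∀ H → restrict H ≈G G → extend (attachment H) ≈G H
  extend-attachment H H↾≈G zero    zero    = ≡-sym (irrefl H zero)
  extend-attachment H H↾≈G zero    (suc j) = lookup∘tabulate _ j
  extend-attachment H H↾≈G (suc i) zero    = trans (lookup∘tabulate _ i) (sym H zero (suc i))
  extend-attachment H H↾≈G (suc i) (suc j) = ≡-sym (H↾≈G i j)

  twinAdj : Bool → Fin n → Fin n → Bool
  twinAdj c v x with v ≟ᶠ x
  ... | yes _ = c
  ... | no  _ = adj G v x

  twinAdj-self : ∀ c v → twinAdj c v v ≡ c
  twinAdj-self c v with v ≟ᶠ v
  ... | yes _   = refl
  ... | no  v≢v = contradiction refl v≢v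

  twinAdj-other : ∀ c {v x} → x ≢ v → twinAdj c v x ≡ adj G v x
  twinAdj-other c {v} {x} x≢v with v ≟ᶠ x
  ... | yes v≡x = contradiction (≡-sym v≡x) x≢v
  ... | no  _   = refl

  forbiddenAdj : Forbidden n → Fin n → Bool
  forbiddenAdj (uniform c) _ = c
  forbiddenAdj (twin c v)    = twinAdj c v

  forbidden : Forbidden n → Subset n
  forbidden s = tabulate (forbiddenAdj s)

  -- A forbidden neighbourhood never gives a prime extension: for ∅ and V the
  -- old vertices form a module, for N(v) and N[v] the pair {new vertex, v} does.
  forbidden-not-prime : ∀ s → ¬ Prime (extend (forbidden s))
  forbidden-not-prime (uniform c) (s≤s (s≤s (s≤s (s≤s _))) , trivial) =
    nontrivial {x = suc zero} {suc (suc zero)} {zero} (there ∈⊤) (there ∈⊤) (λ ()) (λ ())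
      (trivial (false ∷ full) old-module)
    where
    old-module : IsModule (extend (forbidden (uniform c))) (false ∷ full)
    old-module = module-intro (extend (forbidden (uniform c))) (false ∷ full) λ
      { zero    _   → c , λ { (suc x) (there _) → lookup∘tabulate (λ _ → c) x }
      ; (suc v) v∉M → contradiction (there ∈⊤) v∉M }
  forbidden-not-prime (twin c v) (s≤s 3≤n , trivial) =
    nontrivial here (there (x∈⁅x⁆ v)) (λ ()) outside (trivial (true ∷ ⁅ v ⁆) pair-module)
    where
    other = third-vertex 3≤n v v
    outside : suc (proj₁ other) ∉ (true ∷ ⁅ v ⁆)
    outside (there w∈) = proj₁ (proj₂ other) (x∈⁅y⁆⇒x≡y v w∈)
    pair-module : IsModule (extend (forbidden (twin c v))) (true ∷ ⁅ v ⁆)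
    pair-module = module-intro (extend (forbidden (twin c v))) (true ∷ ⁅ v ⁆) λ
      { zero    a∉M → contradiction here a∉M
      ; (suc u) u∉M → adj G u v , λ
          { zero    here        → begin
              at (forbidden (twin c v)) u  ≡⟨ lookup∘tabulate (twinAdj c v) u ⟩
              twinAdj c v u                ≡⟨ twinAdj-other c (λ { refl → u∉M (there (x∈⁅x⁆ v)) }) ⟩
              adj G v u                    ≡⟨ sym G v u ⟩
              adj G u v                    ∎
          ; (suc y) (there y∈) → cong (adj G u) (x∈⁅y⁆⇒x≡y v y∈) } }
      where open ≡-Reasoning

  attachment-allowed : ∀ H → restrict H ≈G G → Prime H → ∀ s → forbidden s ≢ attachment H
  attachment-allowed H H↾≈G H-prime s forbidden≡ = forbidden-not-prime s
    (subst (λ N → Prime (extend N)) (≡-sym forbidden≡)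
      (prime-≈ {H = extend (attachment H)} {H} (extend-attachment H H↾≈G) H-prime))

  module OfPrime (G-prime : Prime G) where

    3≤n : 3 ≤ n
    3≤n = <⇒≤ (proj₁ G-prime)

    some-vertex : Fin n
    some-vertex = fromℕ< (≤-trans (s≤s z≤n) 3≤n)

    G-trivial : ∀ M → IsModule G M → Trivial M
    G-trivial = proj₂ G-prime

    -- No vertex is adjacent to all, or to none, of the others (else V ∖ {v} is a module).
    no-constant-neighbourhood : ∀ v c → ¬ (∀ x → x ≢ v → adj G v x ≡ c)
    no-constant-neighbourhood v c constant with third-vertex 3≤n v v
    ... | x , x≢v , _ with third-vertex 3≤n v x
    ... | _ , y≢v , y≢x =
      nontrivial (in-others x≢v) (in-others y≢v) (≢-sym y≢x) (λ v∈ → x∈∁p⇒x∉p v∈ (x∈⁅x⁆ v))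
        (G-trivial others others-module)
      where
      others = ∁ ⁅ v ⁆
      in-others : ∀ {x} → x ≢ v → x ∈ others
      in-others = x∉p⇒x∈∁p ∘ x≢y⇒x∉⁅y⁆
      others-module : IsModule G others
      others-module = module-intro G others λ u u∉ → case u ≟ᶠ v of λ
        { (yes refl) → c , λ x x∈ → constant x (x∉⁅y⁆⇒x≢y (x∈∁p⇒x∉p x∈))
        ; (no u≢v)   → contradiction (in-others u≢v) u∉ }

    -- G has no twins (else {v, w} is a module).
    no-twins : ∀ {v w} → v ≢ w → ¬ (∀ u → u ≢ v → u ≢ w → adj G v u ≡ adj G w u)
    no-twins {v} {w} v≢w same with third-vertex 3≤n v w
    ... | _ , z≢v , z≢w =
      nontrivial (in-pair (inj₁ refl)) (in-pair (inj₂ refl)) v≢w (Sum.[ z≢v , z≢w ] ∘ from-pair)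
        (G-trivial pair pair-module)
      where
      pair = ⁅ v ⁆ ∪ ⁅ w ⁆
      in-pair : ∀ {x} → x ≡ v ⊎ x ≡ w → x ∈ pair
      in-pair (inj₁ refl) = x∈p∪q⁺ (inj₁ (x∈⁅x⁆ v))
      in-pair (inj₂ refl) = x∈p∪q⁺ (inj₂ (x∈⁅x⁆ w))
      from-pair : ∀ {x} → x ∈ pair → x ≡ v ⊎ x ≡ w
      from-pair = Sum.map (x∈⁅y⁆⇒x≡y v) (x∈⁅y⁆⇒x≡y w) ∘ x∈p∪q⁻ ⁅ v ⁆ ⁅ w ⁆
      pair-module : IsModule G pair
      pair-module = module-intro G pair λ u u∉ → adj G u v , λ x x∈ → sees-pair u u∉ (from-pair x∈)
        where
        sees-pair : ∀ u → u ∉ pair → ∀ {x} → x ≡ v ⊎ x ≡ w → adj G u x ≡ adj G u v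
        sees-pair u u∉ (inj₁ refl) = refl
        sees-pair u u∉ (inj₂ refl) = begin
          adj G u w  ≡⟨ sym G u w ⟩
          adj G w u  ≡⟨ same u (u∉ ∘ in-pair ∘ inj₁) (u∉ ∘ in-pair ∘ inj₂) ⟨
          adj G v u  ≡⟨ sym G v u ⟩
          adj G u v  ∎
          where open ≡-Reasoning

    forbiddenAdj-injective : ∀ s t → (∀ x → forbiddenAdj s x ≡ forbiddenAdj t x) → s ≡ t
    forbiddenAdj-injective (uniform c) (uniform d) agree = cong uniform (agree some-vertex)
    forbiddenAdj-injective (uniform c) (twin d v) agree =
      contradiction (λ x x≢v → ≡-sym (trans (agree x) (twinAdj-other d x≢v))) (no-constant-neighbourhood v c)
    forbiddenAdj-injective (twin c v) (uniform d) agree =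
      ≡-sym (forbiddenAdj-injective (uniform d) (twin c v) (≡-sym ∘ agree))
    forbiddenAdj-injective (twin c v) (twin d w) agree with v ≟ᶠ w
    ... | yes refl = cong (λ c → twin c v) (trans (≡-sym (twinAdj-self c v)) (trans (agree v) (twinAdj-self d v)))
    ... | no  v≢w  = contradiction (λ u u≢v u≢w → begin
          adj G v u      ≡⟨ twinAdj-other c u≢v ⟨
          twinAdj c v u  ≡⟨ agree u ⟩
          twinAdj d w u  ≡⟨ twinAdj-other d u≢w ⟩
          adj G w u      ∎) (no-twins v≢w)
      where open ≡-Reasoning

    forbidden-injective : Injective _≡_ _≡_ forbidden
    forbidden-injective {s} {t} s≡t = forbiddenAdj-injective s t λ x → begin
      forbiddenAdj s x        ≡⟨ lookup∘tabulate (forbiddenAdj s) x ⟨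
      at (forbidden s) x      ≡⟨ cong (λ N → at N x) s≡t ⟩
      at (forbidden t) x      ≡⟨ lookup∘tabulate (forbiddenAdj t) x ⟩
      forbiddenAdj t x        ∎
      where open ≡-Reasoning

    -- A module m ∷ M of
    -- the extension restricts to the module M of G, which is trivial; the only
    -- nontrivial combinations are V (forcing N ∈ {∅, V}) and {new vertex, i}
    -- (forcing N ∈ {N(i), N[i]}).
    extension-prime : ∀ {N} → (∀ s → forbidden s ≢ N) → Prime (extend N)
    extension-prime {N} allowed = s≤s 3≤n , λ { (m ∷ M) isModule →
      lift-trivial m (G-trivial M (module-restrict {H = extend N} {m} isModule)) isModule }
      where
      old-vertices : ¬ IsModule (extend N) (false ∷ full)
      old-vertices isModule =
        let (c , sees) = module-elim (extend N) (false ∷ full) isModule zero λ ()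
        in  allowed (uniform c) (subset-ext λ x → ≡-sym (sees (suc x) (there ∈⊤)))

      pair-with : ∀ i → ¬ IsModule (extend N) (true ∷ ⁅ i ⁆)
      pair-with i isModule = allowed (twin (at N i) i) (subset-ext agrees)
        where
        like-i : ∀ u → u ≢ i → at N u ≡ adj G u i
        like-i u u≢i = trans (sees zero here) (≡-sym (sees (suc i) (there (x∈⁅x⁆ i))))
          where
          sees = proj₂ (module-elim (extend N) (true ∷ ⁅ i ⁆) isModule (suc u)
                          λ { (there u∈) → u≢i (x∈⁅y⁆⇒x≡y i u∈) })
        agrees : ∀ x → twinAdj (at N i) i x ≡ at N x
        agrees x with x ≟ᶠ i
        ... | yes refl = twinAdj-self (at N x) x
        ... | no  x≢i  = trans (twinAdj-other (at N i) x≢i) (trans (sym G i x) (≡-sym (like-i x x≢i)))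

      lift-trivial : ∀ m {M} → Trivial M → IsModule (extend N) (m ∷ M) → Trivial (m ∷ M)
      lift-trivial false (inj₁ refl)               _        = inj₁ refl
      lift-trivial false (inj₂ (inj₁ refl))        isModule = contradiction isModule old-vertices
      lift-trivial false (inj₂ (inj₂ (i , refl))) _        = inj₂ (inj₂ (suc i , refl))
      lift-trivial true  (inj₁ refl)               _        = inj₂ (inj₂ (zero , refl))
      lift-trivial true  (inj₂ (inj₁ refl))        _        = inj₂ (inj₁ refl)
      lift-trivial true  (inj₂ (inj₂ (i , refl))) isModule = contradiction isModule (pair-with i)

lemma4 : ∀ (n : ℕ) (G : Graph n) → Prime G →
    Σ (Fin (2 ^ n ∸ 2 * n ∸ 2) → Graph (suc n)) λ f →
    (∀ k → (restrict (f k) ≈G G) × Prime (f k)) ×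
    (∀ k l → f k ≈G f l → k ≡ l) ×
    (∀ (H : Graph (suc n)) → restrict H ≈G G → Prime H → ∃ λ k → f k ≈G H)
lemma4 n G G-prime =
  let (e , e-injective , e-allowed , e-complete) =
        complement-enumeration (≡-dec Bool._≟_) (allSubsets-unique n) allSubsets-complete
          forbidden-code forbidden forbidden-injective count
  in
  extend ∘ e ,
  (λ k → restrict-extend (e k) , extension-prime (e-allowed k)) ,
  (λ k l fk≈fl → e-injective (extend-injective fk≈fl)) ,
  λ H H↾≈G H-prime →
    let (k , ek≡N) = e-complete (attachment H) (attachment-allowed H H↾≈G H-prime)
    in  k , subst (λ N → extend N ≈G H) (≡-sym ek≡N) (extend-attachment H H↾≈G)
  where
  open Extension G
  open OfPrime G-prime
  count : length (allSubsets n) ∸ (2 * n + 2) ≡ 2 ^ n ∸ 2 * n ∸ 2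
  count = trans (cong (_∸ (2 * n + 2)) (allSubsets-length n)) (≡-sym (∸-+-assoc (2 ^ n) (2 * n) 2))
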